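{- If $L$ is a co-Brouwerian semilattice generated (as a CBS) by a finite subset $X$, then every join-irreducible element of $L$ is a join-irreducible component in $L$ of some element of $X$.
   Context: A co-Brouwerian semilattice (CBS) is a poset with least element $0$, binary joins $\vee$ and a difference $-$ characterized by $a-b\le c$ iff $a\le b\vee c$; generation is with respect to $(0,\vee,-)$. An element $g$ is join-irreducible if for all $n\ge0$ and $b_1,\dots,b_n$, $g\le b_1\vee\dots\vee b_n$ implies $g\le b_i$ for some $i$. A join-irreducible component of $a$ is a maximal element among the join-irreducible elements below $a$. -}

module Defs where

open import Level using (Level; _⊔_; suc)
open import Relation.Binary.Bundles using (Poset)
open import Data.List using (List; []; _∷_; foldr)
open import Data.List.Membership.Propositional using (_∈_)
open import Data.List.Relation.Unary.Any using (Any)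
open import Data.Product using (Σ; _×_; ∃)

record CBS (c ℓ₁ ℓ₂ : Level) : Set (Level.suc (c ⊔ ℓ₁ ⊔ ℓ₂)) where
  field
    poset : Poset c ℓ₁ ℓ₂
  open Poset poset public
  field
    𝟘      : Carrier
    _∨_    : Carrier → Carrier → Carrier
    _−_    : Carrier → Carrier → Carrier
    𝟘-least : ∀ a → 𝟘 ≤ a
    ∨-ubˡ  : ∀ a b → a ≤ (a ∨ b)
    ∨-ubʳ  : ∀ a b → b ≤ (a ∨ b)
    ∨-lub  : ∀ a b c → a ≤ c → b ≤ c → (a ∨ b) ≤ c
    −-adjˡ : ∀ a b c → (a − b) ≤ c → a ≤ (b ∨ c)
    −-adjʳ : ∀ a b c → a ≤ (b ∨ c) → (a − b) ≤ c

  ⋁ : List Carrier → Carrier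
  ⋁ = foldr _∨_ 𝟘

  JoinIrreducible : Carrier → Set (c ⊔ ℓ₂)
  JoinIrreducible g = ∀ (bs : List Carrier) → g ≤ ⋁ bs → Any (λ b → g ≤ b) bs

  JIComponent : Carrier → Carrier → Set (c ⊔ ℓ₁ ⊔ ℓ₂)
  JIComponent g a =
    JoinIrreducible g × g ≤ a ×
    (∀ h → JoinIrreducible h → h ≤ a → g ≤ h → h ≈ g)

  data Term (G : Set c) : Set c where
    gen  : G → Term G
    zero : Term G
    join : Term G → Term G → Term G
    diff : Term G → Term G → Term G

  eval : {G : Set c} → (G → Carrier) → Term G → Carrier
  eval v (gen x)    = v x
  eval v zero       = 𝟘
  eval v (join s t) = eval v s ∨ eval v t
  eval v (diff s t) = eval v s − eval v t

  GeneratedBy : List Carrier → Set (c ⊔ ℓ₁)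
  GeneratedBy X = ∀ a → ∃ λ (t : Term (Σ Carrier (λ x → x ∈ X))) →
                    a ≈ eval Data.Product.proj₁ t

-- Call g essential in a when g ≤ a but g ≰ a − g.  A join-irreducible g essential
-- in a is a component of a: a join-irreducible h with g ≤ h ≤ a ≤ g ∨ (a − g)
-- lies below g, since h ≤ a − g would give g ≤ a − g.  Writing g ≈ t(X) for a
-- (0,∨,−)-term t, g is essential in t(X), and essentiality descends through t:
-- from s ∨ t to s or t by join-irreducibility, and from s − t to s.  It thus
-- reaches a generator x ∈ X.
module Submission where

open import Defs
open import Data.List using (List; []; _∷_)
open import Data.List.Relation.Unary.Any as Any using (Any; here; there)
open import Data.List.Membership.Propositional using (_∈_; lose)
open import Data.Product using (Σ; _×_; _,_; proj₁; proj₂)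
open import Data.Sum using (_⊎_; inj₁; inj₂)
open import Relation.Nullary using (¬_; contradiction)

module CBSProperties {c ℓ₁ ℓ₂} (L : CBS c ℓ₁ ℓ₂) where
  open CBS L

  ≤-∨-− : ∀ a b → a ≤ (b ∨ (a − b))
  ≤-∨-− a b = −-adjˡ a b (a − b) refl

  −-≤ : ∀ a b → (a − b) ≤ a
  −-≤ a b = −-adjʳ a b a (∨-ubʳ b a)

  −-monoˡ-≤ : ∀ {a a′} b → a ≤ a′ → (a − b) ≤ (a′ − b)
  −-monoˡ-≤ {a} {a′} b a≤a′ = −-adjʳ a b (a′ − b) (trans a≤a′ (≤-∨-− a′ b))

  ∨-mono-≤ : ∀ {a a′ b b′} → a ≤ a′ → b ≤ b′ → (a ∨ b) ≤ (a′ ∨ b′)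
  ∨-mono-≤ {a} {a′} {b} {b′} a≤a′ b≤b′ =
    ∨-lub a b _ (trans a≤a′ (∨-ubˡ a′ b′)) (trans b≤b′ (∨-ubʳ a′ b′))

  ≤-∨-∨-−-− : ∀ a b c → a ≤ (c ∨ (b ∨ ((a − b) − c)))
  ≤-∨-∨-−-− a b c = trans (≤-∨-− a b)
    (∨-lub b (a − b) _ (trans (∨-ubˡ b _) (∨-ubʳ c _))
      (trans (≤-∨-− (a − b) c) (∨-mono-≤ refl (∨-ubʳ b _))))

  JoinIrreducible⇒≰𝟘 : ∀ {g} → JoinIrreducible g → ¬ (g ≤ 𝟘)
  JoinIrreducible⇒≰𝟘 ji g≤𝟘 with ji [] g≤𝟘
  ... | ()

  JoinIrreducible⇒prime : ∀ {g} → JoinIrreducible g →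
                          ∀ a b → g ≤ (a ∨ b) → g ≤ a ⊎ g ≤ b
  JoinIrreducible⇒prime ji a b g≤a∨b
    with ji (a ∷ b ∷ []) (trans g≤a∨b (∨-mono-≤ refl (∨-ubˡ b 𝟘)))
  ... | here g≤a         = inj₁ g≤a
  ... | there (here g≤b) = inj₂ g≤b

  Essential : Carrier → Carrier → Set ℓ₂
  Essential g a = g ≤ a × ¬ (g ≤ (a − g))

  essential-refl : ∀ {g} → JoinIrreducible g → Essential g g
  essential-refl ji =
    refl , λ g≤g−g → JoinIrreducible⇒≰𝟘 ji (trans g≤g−g (−-adjʳ _ _ 𝟘 (∨-ubˡ _ 𝟘)))

  essential-respʳ-≈ : ∀ {g a b} → a ≈ b → Essential g a → Essential g b
  essential-respʳ-≈ {g} a≈b (g≤a , g≰a−g) =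
    trans g≤a (reflexive a≈b) ,
    λ g≤b−g → g≰a−g (trans g≤b−g (−-monoˡ-≤ g (reflexive (Eq.sym a≈b))))

  essential-∨ : ∀ {g} → JoinIrreducible g →
                ∀ a b → Essential g (a ∨ b) → Essential g a ⊎ Essential g b
  essential-∨ {g} ji a b (g≤a∨b , g≰a∨b−g) with JoinIrreducible⇒prime ji a b g≤a∨b
  ... | inj₁ g≤a = inj₁ (g≤a , λ g≤a−g → g≰a∨b−g (trans g≤a−g (−-monoˡ-≤ g (∨-ubˡ a b))))
  ... | inj₂ g≤b = inj₂ (g≤b , λ g≤b−g → g≰a∨b−g (trans g≤b−g (−-monoˡ-≤ g (∨-ubʳ a b))))

  essential-− : ∀ {g} → JoinIrreducible g →
                ∀ a b → Essential g (a − b) → Essential g a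
  essential-− {g} ji a b (g≤a−b , g≰a−b−g) = trans g≤a−b (−-≤ a b) , g≰a−g
    where
    a−g≤b∨a−b−g : (a − g) ≤ (b ∨ ((a − b) − g))
    a−g≤b∨a−b−g = −-adjʳ a g _ (≤-∨-∨-−-− a b g)

    -- If g ≤ b then a ≤ b ∨ ((a − b) − g), so a − b ≤ (a − b) − g.
    g≰b : ¬ (g ≤ b)
    g≰b g≤b = g≰a−b−g (trans g≤a−b (−-adjʳ a b _
      (trans (≤-∨-∨-−-− a b g) (∨-lub g _ _ (trans g≤b (∨-ubˡ b _)) refl))))

    g≰a−g : ¬ (g ≤ (a − g))
    g≰a−g g≤a−g with JoinIrreducible⇒prime ji b _ (trans g≤a−g a−g≤b∨a−b−g)
    ... | inj₁ g≤b     = g≰b g≤b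
    ... | inj₂ g≤a−b−g = g≰a−b−g g≤a−b−g

  essential⇒JIComponent : ∀ {g a} → JoinIrreducible g → Essential g a → JIComponent g a
  essential⇒JIComponent {g} {a} ji (g≤a , g≰a−g) = ji , g≤a , λ h jh h≤a g≤h →
    antisym (h≤g h jh h≤a g≤h) g≤h
    where
    h≤g : ∀ h → JoinIrreducible h → h ≤ a → g ≤ h → h ≤ g
    h≤g h jh h≤a g≤h with JoinIrreducible⇒prime jh g (a − g) (trans h≤a (≤-∨-− a g))
    ... | inj₁ h≤g   = h≤g
    ... | inj₂ h≤a−g = contradiction (trans g≤h h≤a−g) g≰a−g

  essential-generator : ∀ {X : List Carrier} {g} → JoinIrreducible g →
                        (t : Term (Σ Carrier (_∈ X))) →
                        Essential g (eval proj₁ t) → Any (Essential g) X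
  essential-generator ji (gen (x , x∈X)) ess = lose x∈X ess
  essential-generator ji zero (g≤𝟘 , _) with JoinIrreducible⇒≰𝟘 ji g≤𝟘
  ... | ()
  essential-generator ji (join s t) ess with essential-∨ ji _ _ ess
  ... | inj₁ ess-s = essential-generator ji s ess-s
  ... | inj₂ ess-t = essential-generator ji t ess-t
  essential-generator ji (diff s t) ess = essential-generator ji s (essential-− ji _ _ ess)

lemma4p3 : ∀ {c ℓ₁ ℓ₂} (L : CBS c ℓ₁ ℓ₂) → let open CBS L in
    (X : List Carrier) → GeneratedBy X →
    ∀ g → JoinIrreducible g → Any (λ x → JIComponent g x) X
lemma4p3 L X generated g ji =
  Any.map (essential⇒JIComponent ji)
    (essential-generator ji t (essential-respʳ-≈ g≈t (essential-refl ji)))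
  where
  open CBS L
  open CBSProperties L
  t : Term (Σ Carrier (_∈ X))
  t = proj₁ (generated g)
  g≈t : g ≈ eval proj₁ t
  g≈t = proj₂ (generated g)
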